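{- Let $M$ be a matroid with $\kappa(M)<r(M)$. Then $\kappa(M^t)=t(\kappa(M)-1)+1$ for every $t\in\mathbb{N}$.
   Context: A cyclic flat of a matroid $M$ is a flat $F$ such that $M|F$ has no coloops; $\mathcal{Z}(M)$ denotes the set of cyclic flats, and a matroid is determined by its cyclic flats and their ranks. The $t$-expansion: fix $t\in\mathbb{N}$; for each $e\in E(M)$ let $S_e$ be a $t$-element set with $e\in S_e$, the sets $S_e$ pairwise disjoint; for $X\subseteq E(M)$ let $S_X=\bigcup_{e\in X}S_e$. The $t$-expansion $M^t$ is the matroid on $S_{E(M)}$ whose cyclic flats are exactly the sets $S_A$ with $A\in\mathcal{Z}(M)$, with $r_{M^t}(S_A)=t\cdot r_M(A)$. For $X\subseteq E(M)$ let $\overline{X}=E(M)-X$ and $\lambda_M(X)=r(X)+r(\overline{X})-r(M)$. A vertical $k$-separation is a pair $(X,\overline{X})$ with $r(X)\geq k$, $r(\overline{X})\geq k$ and $\lambda_M(X)<k$. The vertical connectivity $\kappa(M)$ is the least $k$ such that $M$ has a vertical $k$-separation if one exists (equivalently, if $E(M)$ is a union of two proper flats), and $\kappa(M)=r(M)$ otherwise. -}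

module Defs where

open import Data.Nat using (ℕ; suc; _+_; _*_; _∸_; _≤_; _<_)
open import Data.Fin using (Fin)
open import Data.Fin.Subset using (Subset; ⊤; ∁; _∪_; _∩_; ⁅_⁆; _∈_; _∉_; _⊆_; _-_; ∣_∣)
open import Data.Vec using (tabulate; lookup)
open import Data.Product using (Σ; _×_; ∃; ∃-syntax)
open import Data.Sum using (_⊎_)
open import Relation.Binary.PropositionalEquality using (_≡_)
open import Relation.Nullary using (¬_)
open import Function.Bundles using (_⇔_)

record Matroid (n : ℕ) : Set where
  field
    rk        : Subset n → ℕ
    rk-bound  : ∀ X → rk X ≤ ∣ X ∣
    rk-mono   : ∀ X Y → X ⊆ Y → rk X ≤ rk Y
    rk-submod : ∀ X Y → rk (X ∪ Y) + rk (X ∩ Y) ≤ rk X + rk Y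
open Matroid public

module _ {n : ℕ} (M : Matroid n) where

  rank : ℕ
  rank = rk M ⊤

  IsFlat : Subset n → Set
  IsFlat F = ∀ x → x ∉ F → rk M F < rk M (F ∪ ⁅ x ⁆)

  NoColoopsOn : Subset n → Set
  NoColoopsOn F = ∀ x → x ∈ F → rk M (F - x) ≡ rk M F

  IsCyclicFlat : Subset n → Set
  IsCyclicFlat F = IsFlat F × NoColoopsOn F

  conn : Subset n → ℕ
  conn X = (rk M X + rk M (∁ X)) ∸ rank

  IsVerticalSep : ℕ → Subset n → Set
  IsVerticalSep k X = (k ≤ rk M X) × (k ≤ rk M (∁ X)) × (conn X < k)

  HasVerticalSep : ℕ → Set
  HasVerticalSep k = ∃[ X ] IsVerticalSep k X

  IsVerticalConnectivity : ℕ → Set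
  IsVerticalConnectivity k =
      (HasVerticalSep k × (∀ j → HasVerticalSep j → k ≤ j))
    ⊎ ((∀ j → ¬ HasVerticalSep j) × k ≡ rank)

-- S_X for a block map π : E(M^t) → E(M) (S_e is the fibre of π over e)
preimage : {m n : ℕ} → (Fin m → Fin n) → Subset n → Subset m
preimage π A = tabulate (λ i → lookup A (π i))

record IsExpansion {n m : ℕ} (t : ℕ) (M : Matroid n) (N : Matroid m)
                   (π : Fin m → Fin n) : Set where
  field
    block-size  : ∀ e → ∣ preimage π ⁅ e ⁆ ∣ ≡ t
    cyclicFlats : ∀ Z → IsCyclicFlat N Z ⇔ (∃[ A ] (IsCyclicFlat M A × Z ≡ preimage π A))
    rank-expand : ∀ A → IsCyclicFlat M A → rk N (preimage π A) ≡ t * rk M A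

{-# OPTIONS --safe #-}
module Submission where

-- A descent (delete a coloop of M|X, or add an element spanned by X) shows that every set X
-- of a matroid lies over a cyclic flat Z with r(Z) + |X − Z| ≤ r(X). In M^t every cyclic flat
-- is a block set S_A, so this yields r(S_X) = t·r(X) and λ(S_X) = t·λ(X): a vertical
-- κ-separation of M lifts to a vertical (t(κ−1)+1)-separation of M^t. Conversely, let (Y, E − Y)
-- be a vertical separation of M^t and pick A, B with t·r(A) + |Y − S_A| ≤ r(Y) and
-- t·r(B) + |E − Y − S_B| ≤ r(E − Y). Each element of D = E(M) − (A ∪ B) contributes t elements
-- to Y − S_A or to E − Y − S_B, so t·(r(A) + r(B) + |D|) ≤ λ(Y) + t·r(M). Either D can be shared
-- out so that A ∪ D₁ and its complement both have rank below r(M), which is a vertical separation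
-- of M and forces r(A) + r(B) + |D| ≥ κ − 1 + r(M), or D is too large for that, which gives the
-- same bound outright. Hence λ(Y) ≥ t(κ − 1).

open import Defs
open import Data.Nat using (ℕ; suc; _+_; _*_; _∸_; _≤_; _<_)
open import Data.Fin using (Fin)

open import Data.Bool using (Bool; true; false; not)
open import Data.Fin using (zero; suc)
import Data.Fin as Fin
open import Data.Fin.Properties using (any?)
open import Data.Fin.Subset
open import Data.Fin.Subset.Properties
open import Data.Nat using (zero; z≤n; s≤s; _<?_; _≤?_)
open import Data.Nat.Properties
open import Algebra.Properties.Semiring.Sum +-*-semiring
  using (sum-syntax; ∑-comm; sum-cong-≗; *-distribˡ-sum; sum-replicate-zero)
open import Data.Nat.Tactic.RingSolver using (solve-∀)
open import Data.Product using (∃-syntax; _×_; _,_; proj₂)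
import Data.Product as Product
open import Data.Sum using (inj₁; inj₂; [_,_]′)
import Data.Sum as Sum
open import Data.Vec using (Vec; []; _∷_; here; there; lookup; map)
open import Data.Vec.Properties
  using (lookup∘tabulate; tabulate∘lookup; tabulate-cong; lookup-map; lookup-replicate;
         []=⇒lookup; lookup⇒[]=)
open import Function using (_∘_)
open import Function.Bundles using (Equivalence)
open import Relation.Binary.PropositionalEquality
open import Relation.Nullary using (yes; no; ¬?; contradiction)
open import Relation.Nullary.Decidable using (_×-dec_)

x∈p─q⁻ : ∀ {n} (p q : Subset n) {x} → x ∈ p ─ q → x ∈ p × x ∉ q
x∈p─q⁻ (inside  ∷ p) (outside ∷ q) here = here , λ ()
x∈p─q⁻ (outside ∷ p) (outside ∷ q) {zero} ()
x∈p─q⁻ (s ∷ p) (s′ ∷ q) (there x∈p─q) = Product.map there (_∘ drop-there) (x∈p─q⁻ p q x∈p─q)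

─-monoˡ : ∀ {n} {p q : Subset n} r → p ⊆ q → p ─ r ⊆ q ─ r
─-monoˡ {p = p} r p⊆q x∈p─r =
  let x∈p , x∉r = x∈p─q⁻ p r x∈p─r in x∈p∧x∉q⇒x∈p─q (p⊆q x∈p) x∉r

p⊆q∪[p─q] : ∀ {n} (p q : Subset n) → p ⊆ q ∪ (p ─ q)
p⊆q∪[p─q] p q {x} x∈p with x ∈? q
... | yes x∈q = x∈p∪q⁺ (inj₁ x∈q)
... | no  x∉q = x∈p∪q⁺ (inj₂ (x∈p∧x∉q⇒x∈p─q x∈p x∉q))

∁[p∪r]⊆q∪[∁[p∪q]─r] : ∀ {n} (p q r : Subset n) → ∁ (p ∪ r) ⊆ q ∪ (∁ (p ∪ q) ─ r)
∁[p∪r]⊆q∪[∁[p∪q]─r] p q r {x} x∈∁[p∪r] with x ∈? q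
... | yes x∈q = x∈p∪q⁺ (inj₁ x∈q)
... | no  x∉q = x∈p∪q⁺ (inj₂ (x∈p∧x∉q⇒x∈p─q x∈∁[p∪q] (x∉p∪r ∘ x∈p∪q⁺ ∘ inj₂)))
  where
  x∉p∪r : x ∉ p ∪ r
  x∉p∪r = x∈∁p⇒x∉p x∈∁[p∪r]
  x∈∁[p∪q] : x ∈ ∁ (p ∪ q)
  x∈∁[p∪q] = x∉p⇒x∈∁p ([ x∉p∪r ∘ x∈p∪q⁺ ∘ inj₁ , x∉q ]′ ∘ x∈p∪q⁻ p q)

∣p∪q∣≤∣p∣+∣q∣ : ∀ {n} (p q : Subset n) → ∣ p ∪ q ∣ ≤ ∣ p ∣ + ∣ q ∣
∣p∪q∣≤∣p∣+∣q∣ []            []            = z≤n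
∣p∪q∣≤∣p∣+∣q∣ (outside ∷ p) (outside ∷ q) = ∣p∪q∣≤∣p∣+∣q∣ p q
∣p∪q∣≤∣p∣+∣q∣ (inside  ∷ p) (outside ∷ q) = s≤s (∣p∪q∣≤∣p∣+∣q∣ p q)
∣p∪q∣≤∣p∣+∣q∣ (outside ∷ p) (inside  ∷ q) =
  subst (suc ∣ p ∪ q ∣ ≤_) (sym (+-suc ∣ p ∣ ∣ q ∣)) (s≤s (∣p∪q∣≤∣p∣+∣q∣ p q))
∣p∪q∣≤∣p∣+∣q∣ (inside  ∷ p) (inside  ∷ q) =
  s≤s (≤-trans (∣p∪q∣≤∣p∣+∣q∣ p q) (+-monoʳ-≤ ∣ p ∣ (n≤1+n ∣ q ∣)))

∣p─p∣≡0 : ∀ {n} (p : Subset n) → ∣ p ─ p ∣ ≡ 0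
∣p─p∣≡0 {n} p = n≤0⇒n≡0 (≤-trans (p⊆q⇒∣p∣≤∣q∣ p─p⊆⊥) (≤-reflexive (∣⊥∣≡0 n)))
  where
  p─p⊆⊥ : p ─ p ⊆ ⊥
  p─p⊆⊥ x∈p─p = let x∈p , x∉p = x∈p─q⁻ p p x∈p─p in contradiction x∈p x∉p

∣p∣≤∣p-x∣+1 : ∀ {n} (p : Subset n) x → ∣ p ∣ ≤ ∣ p - x ∣ + 1
∣p∣≤∣p-x∣+1 p x = begin
  ∣ p ∣                   ≤⟨ p⊆q⇒∣p∣≤∣q∣ p⊆[p-x]∪⁅x⁆ ⟩
  ∣ (p - x) ∪ ⁅ x ⁆ ∣     ≤⟨ ∣p∪q∣≤∣p∣+∣q∣ (p - x) ⁅ x ⁆ ⟩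
  ∣ p - x ∣ + ∣ ⁅ x ⁆ ∣   ≡⟨ cong (∣ p - x ∣ +_) (∣⁅x⁆∣≡1 x) ⟩
  ∣ p - x ∣ + 1           ∎
  where
  open ≤-Reasoning
  p⊆[p-x]∪⁅x⁆ : p ⊆ (p - x) ∪ ⁅ x ⁆
  p⊆[p-x]∪⁅x⁆ {y} y∈p with y Fin.≟ x
  ... | yes refl = x∈p∪q⁺ (inj₂ (x∈⁅x⁆ x))
  ... | no  y≢x  = x∈p∪q⁺ (inj₁ (x∈p∧x≢y⇒x∈p-y y∈p y≢x))

∣p∣≤m+n⇒split : ∀ {n} (p : Subset n) a b → ∣ p ∣ ≤ a + b →
                ∃[ q ] ∣ q ∣ ≤ a × ∣ p ─ q ∣ ≤ b × ∣ q ∣ + ∣ p ─ q ∣ ≡ ∣ p ∣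
∣p∣≤m+n⇒split []            a       b       _ = [] , z≤n , z≤n , refl
∣p∣≤m+n⇒split (outside ∷ p) a       b       ∣p∣≤a+b
  with q , ∣q∣≤a , ∣p─q∣≤b , eq ← ∣p∣≤m+n⇒split p a b ∣p∣≤a+b =
  outside ∷ q , ∣q∣≤a , ∣p─q∣≤b , eq
∣p∣≤m+n⇒split (inside ∷ p)  (suc a) b       (s≤s ∣p∣≤a+b)
  with q , ∣q∣≤a , ∣p─q∣≤b , eq ← ∣p∣≤m+n⇒split p a b ∣p∣≤a+b =
  inside ∷ q , s≤s ∣q∣≤a , ∣p─q∣≤b , cong suc eq
∣p∣≤m+n⇒split (inside ∷ p)  zero    (suc b) (s≤s ∣p∣≤b)
  with q , ∣q∣≤0 , ∣p─q∣≤b , eq ← ∣p∣≤m+n⇒split p zero b ∣p∣≤b =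
  outside ∷ q , ∣q∣≤0 , s≤s ∣p─q∣≤b , trans (+-suc ∣ q ∣ _) (cong suc eq)

lookup-ext : ∀ {A : Set} {n} {xs ys : Vec A n} → (∀ i → lookup xs i ≡ lookup ys i) → xs ≡ ys
lookup-ext {xs = xs} {ys} eq =
  trans (sym (tabulate∘lookup xs)) (trans (tabulate-cong eq) (tabulate∘lookup ys))

𝟙 : Bool → ℕ
𝟙 true  = 1
𝟙 false = 0

∣p∣≡∑𝟙 : ∀ {n} (p : Subset n) → ∣ p ∣ ≡ ∑[ i < n ] 𝟙 (lookup p i)
∣p∣≡∑𝟙 []            = refl
∣p∣≡∑𝟙 (inside  ∷ p) = cong suc (∣p∣≡∑𝟙 p)
∣p∣≡∑𝟙 (outside ∷ p) = ∣p∣≡∑𝟙 p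

∑-𝟙⁅⁆ : ∀ {n} (g : Fin n → ℕ) x → ∑[ e < n ] (g e * 𝟙 (lookup ⁅ e ⁆ x)) ≡ g x
∑-𝟙⁅⁆ {suc n} g zero = begin
  g zero * 1 + ∑[ e < n ] (g (suc e) * 0)
    ≡⟨ cong₂ _+_ (*-identityʳ (g zero)) (sum-cong-≗ (*-zeroʳ ∘ g ∘ suc)) ⟩
  g zero + ∑[ e < n ] 0
    ≡⟨ cong (g zero +_) (sum-replicate-zero n) ⟩
  g zero + 0
    ≡⟨ +-identityʳ (g zero) ⟩
  g zero ∎
  where open ≡-Reasoning
∑-𝟙⁅⁆ {suc n} g (suc x) = begin
  g zero * 𝟙 (lookup ⊥ x) + rest
    ≡⟨ cong (λ b → g zero * 𝟙 b + rest) (lookup-replicate x outside) ⟩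
  g zero * 0 + rest
    ≡⟨ cong (_+ rest) (*-zeroʳ (g zero)) ⟩
  rest
    ≡⟨ ∑-𝟙⁅⁆ (g ∘ suc) x ⟩
  g (suc x) ∎
  where
  open ≡-Reasoning
  rest : ℕ
  rest = ∑[ e < n ] (g (suc e) * 𝟙 (lookup ⁅ e ⁆ x))

module _ {m n} (π : Fin m → Fin n) where

  lookup-preimage : ∀ A i → lookup (preimage π A) i ≡ lookup A (π i)
  lookup-preimage A i = lookup∘tabulate _ i

  ∈-preimage⁺ : ∀ {A i} → π i ∈ A → i ∈ preimage π A
  ∈-preimage⁺ {A} {i} πi∈A =
    lookup⇒[]= i _ (trans (lookup-preimage A i) ([]=⇒lookup πi∈A))

  ∈-preimage⁻ : ∀ {A i} → i ∈ preimage π A → π i ∈ A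
  ∈-preimage⁻ {A} {i} i∈SA =
    lookup⇒[]= (π i) A (trans (sym (lookup-preimage A i)) ([]=⇒lookup i∈SA))

  preimage-mono : ∀ {A B} → A ⊆ B → preimage π A ⊆ preimage π B
  preimage-mono {A} A⊆B = ∈-preimage⁺ ∘ A⊆B ∘ ∈-preimage⁻ {A}

  preimage-∪-⊆ : ∀ A B → preimage π (A ∪ B) ⊆ preimage π A ∪ preimage π B
  preimage-∪-⊆ A B i∈ =
    x∈p∪q⁺ (Sum.map ∈-preimage⁺ ∈-preimage⁺ (x∈p∪q⁻ A B (∈-preimage⁻ {A ∪ B} i∈)))

  preimage-map : ∀ f A → preimage π (map f A) ≡ map f (preimage π A)
  preimage-map f A = lookup-ext λ i → begin
    lookup (preimage π (map f A)) i ≡⟨ lookup-preimage (map f A) i ⟩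
    lookup (map f A) (π i)          ≡⟨ lookup-map (π i) f A ⟩
    f (lookup A (π i))              ≡⟨ cong f (lookup-preimage A i) ⟨
    f (lookup (preimage π A) i)     ≡⟨ lookup-map i f (preimage π A) ⟨
    lookup (map f (preimage π A)) i ∎
    where open ≡-Reasoning

  preimage-∁ : ∀ A → preimage π (∁ A) ≡ ∁ (preimage π A)
  preimage-∁ = preimage-map not

  preimage-─ : ∀ A B → preimage π (A ─ B) ≡ preimage π A ─ preimage π B
  preimage-─ A B = ⊆-antisym
    (λ i∈S[A─B] → let πi∈A , πi∉B = x∈p─q⁻ A B (∈-preimage⁻ {A ─ B} i∈S[A─B]) in
      x∈p∧x∉q⇒x∈p─q (∈-preimage⁺ πi∈A) (πi∉B ∘ ∈-preimage⁻ {B}))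
    (λ i∈SA─SB → let i∈SA , i∉SB = x∈p─q⁻ (preimage π A) (preimage π B) i∈SA─SB in
      ∈-preimage⁺ {A ─ B} (x∈p∧x∉q⇒x∈p─q (∈-preimage⁻ i∈SA) (i∉SB ∘ ∈-preimage⁺)))

  preimage-⊤ : preimage π ⊤ ≡ ⊤
  preimage-⊤ = lookup-ext λ i →
    trans (lookup-preimage ⊤ i) (trans (lookup-replicate (π i) inside) (sym (lookup-replicate i inside)))

  ∣preimage∣≡∑∣fibre∣ : ∀ A → ∣ preimage π A ∣ ≡ ∑[ e < n ] (𝟙 (lookup A e) * ∣ preimage π ⁅ e ⁆ ∣)
  ∣preimage∣≡∑∣fibre∣ A = begin
    ∣ preimage π A ∣
      ≡⟨ ∣p∣≡∑𝟙 (preimage π A) ⟩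
    ∑[ i < m ] 𝟙 (lookup (preimage π A) i)
      ≡⟨ sum-cong-≗ (λ i → trans (cong 𝟙 (lookup-preimage A i)) (sym (∑-𝟙⁅⁆ (𝟙 ∘ lookup A) (π i)))) ⟩
    ∑[ i < m ] ∑[ e < n ] (𝟙 (lookup A e) * 𝟙 (lookup ⁅ e ⁆ (π i)))
      ≡⟨ ∑-comm (λ i e → 𝟙 (lookup A e) * 𝟙 (lookup ⁅ e ⁆ (π i))) ⟩
    ∑[ e < n ] ∑[ i < m ] (𝟙 (lookup A e) * 𝟙 (lookup ⁅ e ⁆ (π i)))
      ≡⟨ sum-cong-≗ (λ e → *-distribˡ-sum (𝟙 (lookup A e)) (λ i → 𝟙 (lookup ⁅ e ⁆ (π i)))) ⟨
    ∑[ e < n ] (𝟙 (lookup A e) * ∑[ i < m ] 𝟙 (lookup ⁅ e ⁆ (π i)))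
      ≡⟨ sum-cong-≗ (λ e → cong (𝟙 (lookup A e) *_) (∣fibre∣ e)) ⟨
    ∑[ e < n ] (𝟙 (lookup A e) * ∣ preimage π ⁅ e ⁆ ∣) ∎
    where
    open ≡-Reasoning
    ∣fibre∣ : ∀ e → ∣ preimage π ⁅ e ⁆ ∣ ≡ ∑[ i < m ] 𝟙 (lookup ⁅ e ⁆ (π i))
    ∣fibre∣ e = trans (∣p∣≡∑𝟙 (preimage π ⁅ e ⁆)) (sum-cong-≗ (cong 𝟙 ∘ lookup-preimage ⁅ e ⁆))

  ∣preimage∣≡t*∣p∣ : ∀ t → (∀ e → ∣ preimage π ⁅ e ⁆ ∣ ≡ t) → ∀ A → ∣ preimage π A ∣ ≡ t * ∣ A ∣
  ∣preimage∣≡t*∣p∣ t ∣fibre∣≡t A = begin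
    ∣ preimage π A ∣                                   ≡⟨ ∣preimage∣≡∑∣fibre∣ A ⟩
    ∑[ e < n ] (𝟙 (lookup A e) * ∣ preimage π ⁅ e ⁆ ∣)  ≡⟨ sum-cong-≗ 𝟙*∣fibre∣≡t*𝟙 ⟩
    ∑[ e < n ] (t * 𝟙 (lookup A e))                    ≡⟨ *-distribˡ-sum t (𝟙 ∘ lookup A) ⟨
    t * ∑[ e < n ] 𝟙 (lookup A e)                      ≡⟨ cong (t *_) (∣p∣≡∑𝟙 A) ⟨
    t * ∣ A ∣                                          ∎
    where
    open ≡-Reasoning
    𝟙*∣fibre∣≡t*𝟙 : ∀ e → 𝟙 (lookup A e) * ∣ preimage π ⁅ e ⁆ ∣ ≡ t * 𝟙 (lookup A e)
    𝟙*∣fibre∣≡t*𝟙 e = trans (cong (𝟙 (lookup A e) *_) (∣fibre∣≡t e)) (*-comm _ t)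

module MatroidProperties {n} (M : Matroid n) where

  rk-∪ : ∀ P Q → rk M (P ∪ Q) ≤ rk M P + rk M Q
  rk-∪ P Q = ≤-trans (m≤m+n _ _) (rk-submod M P Q)

  rk-∪-∣∣ : ∀ P Q → rk M (P ∪ Q) ≤ rk M P + ∣ Q ∣
  rk-∪-∣∣ P Q = ≤-trans (rk-∪ P Q) (+-monoʳ-≤ (rk M P) (rk-bound M Q))

  rank≤rk+rk∁ : ∀ X → rank M ≤ rk M X + rk M (∁ X)
  rank≤rk+rk∁ X = subst (λ E → rk M E ≤ rk M X + rk M (∁ X)) (p∪∁p≡⊤ X) (rk-∪ X (∁ X))

  conn+rank : ∀ X → conn M X + rank M ≡ rk M X + rk M (∁ X)
  conn+rank X = m∸n+n≡m (rank≤rk+rk∁ X)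

  CyclicFlatBelow : Subset n → Set
  CyclicFlatBelow X = ∃[ Z ] IsCyclicFlat M Z × rk M Z + ∣ X ─ Z ∣ ≤ rk M X

  cyclicFlatBelow-self : ∀ {X} → IsCyclicFlat M X → CyclicFlatBelow X
  cyclicFlatBelow-self {X} cyclicFlat =
    X , cyclicFlat , ≤-reflexive (trans (cong (rk M X +_) (∣p─p∣≡0 X)) (+-identityʳ _))

  cyclicFlatBelow-coloop : ∀ X x → rk M (X - x) < rk M X →
                           CyclicFlatBelow (X - x) → CyclicFlatBelow X
  cyclicFlatBelow-coloop X x coloop (Z , cyclicFlat , bound) = Z , cyclicFlat , (begin
    rk M Z + ∣ X ─ Z ∣             ≤⟨ +-monoʳ-≤ (rk M Z) (∣p∣≤∣p-x∣+1 (X ─ Z) x) ⟩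
    rk M Z + (∣ X ─ Z - x ∣ + 1)   ≡⟨ cong (λ W → rk M Z + (∣ W ∣ + 1)) (p─q─r≡p─r─q X Z ⁅ x ⁆) ⟩
    rk M Z + (∣ X - x ─ Z ∣ + 1)   ≡⟨ +-assoc (rk M Z) _ 1 ⟨
    rk M Z + ∣ X - x ─ Z ∣ + 1     ≤⟨ +-monoˡ-≤ 1 bound ⟩
    rk M (X - x) + 1               ≡⟨ +-comm _ 1 ⟩
    suc (rk M (X - x))             ≤⟨ coloop ⟩
    rk M X                         ∎)
    where open ≤-Reasoning

  cyclicFlatBelow-spanned : ∀ X y → rk M (X ∪ ⁅ y ⁆) ≤ rk M X →
                            CyclicFlatBelow (X ∪ ⁅ y ⁆) → CyclicFlatBelow X
  cyclicFlatBelow-spanned X y spanned (Z , cyclicFlat , bound) = Z , cyclicFlat , (begin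
    rk M Z + ∣ X ─ Z ∣             ≤⟨ +-monoʳ-≤ (rk M Z) (p⊆q⇒∣p∣≤∣q∣ X─Z⊆[X∪y]─Z) ⟩
    rk M Z + ∣ X ∪ ⁅ y ⁆ ─ Z ∣     ≤⟨ bound ⟩
    rk M (X ∪ ⁅ y ⁆)               ≤⟨ spanned ⟩
    rk M X                         ∎)
    where
    open ≤-Reasoning
    X─Z⊆[X∪y]─Z : X ─ Z ⊆ X ∪ ⁅ y ⁆ ─ Z
    X─Z⊆[X∪y]─Z = ─-monoˡ {p = X} Z (p⊆p∪q ⁅ y ⁆)

  -- Weighting r(X) twice makes deleting a coloop of M|X (r drops by 1, |E − X| grows by 1)
  -- decrease the potential, as does adding a spanned element (|E − X| shrinks).
  potential : Subset n → ℕ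
  potential X = 2 * rk M X + ∣ ∁ X ∣

  potential-coloop : ∀ X x → rk M (X - x) < rk M X → potential (X - x) < potential X
  potential-coloop X x coloop = begin-strict
    2 * rk M (X - x) + ∣ ∁ (X - x) ∣       ≤⟨ +-monoʳ-≤ (2 * rk M (X - x)) ∣∁[X-x]∣≤∣∁X∣+1 ⟩
    2 * rk M (X - x) + (∣ ∁ X ∣ + 1)       <⟨ ≤-refl ⟩
    suc (2 * rk M (X - x) + (∣ ∁ X ∣ + 1)) ≡⟨ regroup (rk M (X - x)) ∣ ∁ X ∣ ⟩
    2 * suc (rk M (X - x)) + ∣ ∁ X ∣       ≤⟨ +-monoˡ-≤ ∣ ∁ X ∣ (*-monoʳ-≤ 2 coloop) ⟩
    2 * rk M X + ∣ ∁ X ∣                   ∎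
    where
    open ≤-Reasoning
    regroup : ∀ r c → suc (2 * r + (c + 1)) ≡ 2 * suc r + c
    regroup = solve-∀
    ∁[X-x]-x⊆∁X : ∁ (X - x) - x ⊆ ∁ X
    ∁[X-x]-x⊆∁X y∈ = let y∈∁[X-x] , y∉⁅x⁆ = x∈p─q⁻ (∁ (X - x)) ⁅ x ⁆ y∈ in
      x∉p⇒x∈∁p (λ y∈X → x∈∁p⇒x∉p y∈∁[X-x] (x∈p∧x∉q⇒x∈p─q y∈X y∉⁅x⁆))
    ∣∁[X-x]∣≤∣∁X∣+1 : ∣ ∁ (X - x) ∣ ≤ ∣ ∁ X ∣ + 1
    ∣∁[X-x]∣≤∣∁X∣+1 =
      ≤-trans (∣p∣≤∣p-x∣+1 (∁ (X - x)) x) (+-monoˡ-≤ 1 (p⊆q⇒∣p∣≤∣q∣ ∁[X-x]-x⊆∁X))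

  potential-spanned : ∀ X y → y ∉ X → rk M (X ∪ ⁅ y ⁆) ≤ rk M X →
                      potential (X ∪ ⁅ y ⁆) < potential X
  potential-spanned X y y∉X spanned =
    +-mono-≤-< (*-monoʳ-≤ 2 spanned) (p⊂q⇒∣p∣<∣q∣ ∁[X∪y]⊂∁X)
    where
    ∁[X∪y]⊂∁X : ∁ (X ∪ ⁅ y ⁆) ⊂ ∁ X
    ∁[X∪y]⊂∁X = p⊂q⇒∁p⊃∁q (p⊆p∪q ⁅ y ⁆ , y , x∈p∪q⁺ (inj₂ (x∈⁅x⁆ y)) , y∉X)

  cyclicFlatBelow : ∀ X → CyclicFlatBelow X
  cyclicFlatBelow X = descend (suc (potential X)) X ≤-refl
    where
    descend : ∀ b X → potential X < b → CyclicFlatBelow X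
    descend (suc b) X <b with any? (λ x → rk M (X - x) <? rk M X)
    ... | yes (x , coloop) = cyclicFlatBelow-coloop X x coloop
      (descend b (X - x) (<-≤-trans (potential-coloop X x coloop) (≤-pred <b)))
    ... | no noColoop with any? (λ y → ¬? (y ∈? X) ×-dec rk M (X ∪ ⁅ y ⁆) ≤? rk M X)
    ...   | yes (y , y∉X , spanned) = cyclicFlatBelow-spanned X y spanned
      (descend b (X ∪ ⁅ y ⁆) (<-≤-trans (potential-spanned X y y∉X spanned) (≤-pred <b)))
    ...   | no noSpanned = cyclicFlatBelow-self (flat , noColoops)
      where
      flat : IsFlat M X
      flat y y∉X = ≰⇒> (λ spanned → noSpanned (y , y∉X , spanned))
      noColoops : NoColoopsOn M X
      noColoops x _ = ≤-antisym (rk-mono M _ _ (p─q⊆p X ⁅ x ⁆))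
                                (≮⇒≥ (λ coloop → noColoop (x , coloop)))

  private
    exchange-< : ∀ {c R x y} → c + R ≡ x + y → c < y → x < R
    exchange-< {c} {R} {x} {y} eq c<y = +-cancelʳ-< y x R (begin-strict
      x + y ≡⟨ eq ⟨
      c + R <⟨ +-monoˡ-< R c<y ⟩
      y + R ≡⟨ +-comm y R ⟩
      R + y ∎)
      where open ≤-Reasoning

    exchange-> : ∀ {c R x y} → c + R ≡ x + y → x < R → c < y
    exchange-> {c} {R} {x} {y} eq x<R = +-cancelʳ-< R c y (begin-strict
      c + R ≡⟨ eq ⟩
      x + y <⟨ +-monoˡ-< y x<R ⟩
      R + y ≡⟨ +-comm R y ⟩
      y + R ∎)
      where open ≤-Reasoning

    conn+rank′ : ∀ X → conn M X + rank M ≡ rk M (∁ X) + rk M X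
    conn+rank′ X = trans (conn+rank X) (+-comm (rk M X) _)

  verticalSep⇒rk<rank : ∀ {k X} → IsVerticalSep M k X → rk M X < rank M × rk M (∁ X) < rank M
  verticalSep⇒rk<rank {X = X} (k≤rX , k≤r∁X , conn<k) =
    exchange-< (conn+rank X) (<-≤-trans conn<k k≤r∁X) ,
    exchange-< (conn+rank′ X) (<-≤-trans conn<k k≤rX)

  rk<rank⇒verticalSep : ∀ {X} → rk M X < rank M → rk M (∁ X) < rank M →
                        IsVerticalSep M (suc (conn M X)) X
  rk<rank⇒verticalSep {X} rX<R r∁X<R =
    exchange-> (conn+rank′ X) r∁X<R , exchange-> (conn+rank X) rX<R , ≤-refl

  BelowVerticalSeps : ℕ → Set
  BelowVerticalSeps k = ∀ j → HasVerticalSep M j → k ≤ j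

  private
    +[∸suc]< : ∀ {a R} → a < R → a + (R ∸ suc a) < R
    +[∸suc]< a<R = ≤-reflexive (m+[n∸m]≡n a<R)

  k∸1+rank≤rk+rk+∣∁∪∣-split : ∀ {k} → BelowVerticalSeps k →
    ∀ A B → rk M A < rank M → rk M B < rank M →
    ∣ ∁ (A ∪ B) ∣ ≤ (rank M ∸ suc (rk M A)) + (rank M ∸ suc (rk M B)) →
    k ∸ 1 + rank M ≤ rk M A + rk M B + ∣ ∁ (A ∪ B) ∣
  k∸1+rank≤rk+rk+∣∁∪∣-split {k} minimal A B a<R b<R small
    with D₁ , ∣D₁∣≤a′ , ∣D₂∣≤b′ , ∣D₁∣+∣D₂∣≡d ← ∣p∣≤m+n⇒split (∁ (A ∪ B)) _ _ small = begin
    k ∸ 1 + rank M                ≤⟨ +-monoˡ-≤ (rank M) (∸-monoˡ-≤ 1 k≤1+connX) ⟩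
    conn M X + rank M             ≡⟨ conn+rank X ⟩
    rk M X + rk M (∁ X)           ≤⟨ +-mono-≤ rX≤a+∣D₁∣ r∁X≤b+∣D₂∣ ⟩
    (a + ∣ D₁ ∣) + (b + ∣ D₂ ∣)   ≡⟨ regroup a (∣ D₁ ∣) b (∣ D₂ ∣) ⟩
    a + b + (∣ D₁ ∣ + ∣ D₂ ∣)     ≡⟨ cong (a + b +_) ∣D₁∣+∣D₂∣≡d ⟩
    a + b + ∣ ∁ (A ∪ B) ∣         ∎
    where
    open ≤-Reasoning
    a = rk M A
    b = rk M B
    X = A ∪ D₁
    D₂ = ∁ (A ∪ B) ─ D₁
    regroup : ∀ a d₁ b d₂ → (a + d₁) + (b + d₂) ≡ a + b + (d₁ + d₂)
    regroup = solve-∀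
    rX≤a+∣D₁∣ : rk M X ≤ a + ∣ D₁ ∣
    rX≤a+∣D₁∣ = rk-∪-∣∣ A D₁
    r∁X≤b+∣D₂∣ : rk M (∁ X) ≤ b + ∣ D₂ ∣
    r∁X≤b+∣D₂∣ = ≤-trans (rk-mono M _ _ (∁[p∪r]⊆q∪[∁[p∪q]─r] A B D₁)) (rk-∪-∣∣ B D₂)
    k≤1+connX : k ≤ suc (conn M X)
    k≤1+connX = minimal _ (X , rk<rank⇒verticalSep
      (≤-<-trans rX≤a+∣D₁∣ (≤-<-trans (+-monoʳ-≤ a ∣D₁∣≤a′) (+[∸suc]< a<R)))
      (≤-<-trans r∁X≤b+∣D₂∣ (≤-<-trans (+-monoʳ-≤ b ∣D₂∣≤b′) (+[∸suc]< b<R))))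

  k∸1+rank≤rk+rk+∣∁∪∣-large : ∀ {k} → k < rank M →
    ∀ A B → rk M A < rank M → rk M B < rank M →
    (rank M ∸ suc (rk M A)) + (rank M ∸ suc (rk M B)) < ∣ ∁ (A ∪ B) ∣ →
    k ∸ 1 + rank M ≤ rk M A + rk M B + ∣ ∁ (A ∪ B) ∣
  k∸1+rank≤rk+rk+∣∁∪∣-large {k} k<R A B a<R b<R large = ≤-pred (begin
    suc (k ∸ 1 + R)               ≤⟨ +-monoˡ-≤ R (≤-<-trans (m∸n≤m k 1) k<R) ⟩
    R + R                         ≡⟨ cong₂ _+_ (m+[n∸m]≡n a<R) (m+[n∸m]≡n b<R) ⟨
    (suc a + a′) + (suc b + b′)   ≡⟨ regroup a a′ b b′ ⟩
    suc (a + b + suc (a′ + b′))   ≤⟨ s≤s (+-monoʳ-≤ (a + b) large) ⟩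
    suc (a + b + ∣ ∁ (A ∪ B) ∣)   ∎)
    where
    open ≤-Reasoning
    R = rank M
    a = rk M A
    b = rk M B
    a′ = R ∸ suc a
    b′ = R ∸ suc b
    regroup : ∀ a a′ b b′ → (suc a + a′) + (suc b + b′) ≡ suc (a + b + suc (a′ + b′))
    regroup = solve-∀

  k∸1+rank≤rk+rk+∣∁∪∣ : ∀ {k} → k < rank M → BelowVerticalSeps k →
    ∀ A B → rk M A < rank M → rk M B < rank M →
    k ∸ 1 + rank M ≤ rk M A + rk M B + ∣ ∁ (A ∪ B) ∣
  k∸1+rank≤rk+rk+∣∁∪∣ k<R minimal A B a<R b<R
    with ∣ ∁ (A ∪ B) ∣ ≤? (rank M ∸ suc (rk M A)) + (rank M ∸ suc (rk M B))
  ... | yes small = k∸1+rank≤rk+rk+∣∁∪∣-split minimal A B a<R b<R small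
  ... | no  large = k∸1+rank≤rk+rk+∣∁∪∣-large k<R A B a<R b<R (≰⇒> large)

module Expansion {n m t} {M : Matroid n} {N : Matroid m} {π : Fin m → Fin n}
                 (expansion : IsExpansion t M N π) where
  open IsExpansion expansion
  open MatroidProperties

  ∣preimage∣ : ∀ A → ∣ preimage π A ∣ ≡ t * ∣ A ∣
  ∣preimage∣ = ∣preimage∣≡t*∣p∣ π t block-size

  blockSetBelow : ∀ Y → ∃[ A ] t * rk M A + ∣ Y ─ preimage π A ∣ ≤ rk N Y
  blockSetBelow Y
    with Z , cyclicZ , bound ← cyclicFlatBelow N Y
    with A , cyclicA , refl ← Equivalence.to (cyclicFlats Z) cyclicZ =
    A , subst (λ r → r + ∣ Y ─ preimage π A ∣ ≤ rk N Y) (rank-expand A cyclicA) bound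

  rk-preimage : ∀ X → rk N (preimage π X) ≡ t * rk M X
  rk-preimage X = ≤-antisym upper lower
    where
    upper : rk N (preimage π X) ≤ t * rk M X
    upper with Z , cyclicZ , bound ← cyclicFlatBelow M X = begin
      rk N (preimage π X)                            ≤⟨ rk-mono N _ _ SX⊆SZ∪S[X─Z] ⟩
      rk N (preimage π Z ∪ preimage π (X ─ Z))       ≤⟨ rk-∪-∣∣ N _ _ ⟩
      rk N (preimage π Z) + ∣ preimage π (X ─ Z) ∣
        ≡⟨ cong₂ _+_ (rank-expand Z cyclicZ) (∣preimage∣ (X ─ Z)) ⟩
      t * rk M Z + t * ∣ X ─ Z ∣                     ≡⟨ *-distribˡ-+ t _ _ ⟨
      t * (rk M Z + ∣ X ─ Z ∣)                       ≤⟨ *-monoʳ-≤ t bound ⟩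
      t * rk M X                                     ∎
      where
      open ≤-Reasoning
      SX⊆SZ∪S[X─Z] : preimage π X ⊆ preimage π Z ∪ preimage π (X ─ Z)
      SX⊆SZ∪S[X─Z] = preimage-∪-⊆ π Z (X ─ Z) ∘ preimage-mono π (p⊆q∪[p─q] X Z)
    lower : t * rk M X ≤ rk N (preimage π X)
    lower with A , bound ← blockSetBelow (preimage π X) = begin
      t * rk M X                                     ≤⟨ *-monoʳ-≤ t rX≤rA+∣X─A∣ ⟩
      t * (rk M A + ∣ X ─ A ∣)                       ≡⟨ *-distribˡ-+ t _ _ ⟩
      t * rk M A + t * ∣ X ─ A ∣                     ≡⟨ cong (t * rk M A +_) ∣SX─SA∣≡t*∣X─A∣ ⟨
      t * rk M A + ∣ preimage π X ─ preimage π A ∣   ≤⟨ bound ⟩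
      rk N (preimage π X)                            ∎
      where
      open ≤-Reasoning
      rX≤rA+∣X─A∣ : rk M X ≤ rk M A + ∣ X ─ A ∣
      rX≤rA+∣X─A∣ = ≤-trans (rk-mono M _ _ (p⊆q∪[p─q] X A)) (rk-∪-∣∣ M A (X ─ A))
      ∣SX─SA∣≡t*∣X─A∣ : ∣ preimage π X ─ preimage π A ∣ ≡ t * ∣ X ─ A ∣
      ∣SX─SA∣≡t*∣X─A∣ = trans (cong ∣_∣ (sym (preimage-─ π X A))) (∣preimage∣ (X ─ A))

  rank-expansion : rank N ≡ t * rank M
  rank-expansion = trans (cong (rk N) (sym (preimage-⊤ π))) (rk-preimage ⊤)

  rk∁-preimage : ∀ X → rk N (∁ (preimage π X)) ≡ t * rk M (∁ X)
  rk∁-preimage X = trans (cong (rk N) (sym (preimage-∁ π X))) (rk-preimage (∁ X))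

  conn-preimage : ∀ X → conn N (preimage π X) ≡ t * conn M X
  conn-preimage X = begin
    rk N (preimage π X) + rk N (∁ (preimage π X)) ∸ rank N
      ≡⟨ cong₂ _∸_ (cong₂ _+_ (rk-preimage X) (rk∁-preimage X)) rank-expansion ⟩
    t * rk M X + t * rk M (∁ X) ∸ t * rank M
      ≡⟨ cong (_∸ t * rank M) (*-distribˡ-+ t (rk M X) _) ⟨
    t * (rk M X + rk M (∁ X)) ∸ t * rank M
      ≡⟨ *-distribˡ-∸ t (rk M X + rk M (∁ X)) (rank M) ⟨
    t * conn M X ∎
    where open ≡-Reasoning

  verticalSep-preimage : ∀ {k X} → 1 ≤ t → IsVerticalSep M (suc k) X →
                         IsVerticalSep N (t * k + 1) (preimage π X)
  verticalSep-preimage {k} {X} 1≤t (k<rX , k<r∁X , conn≤k) =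
    ≤-trans t*k+1≤t*[1+k] (≤-trans (*-monoʳ-≤ t k<rX) (≤-reflexive (sym (rk-preimage X)))) ,
    ≤-trans t*k+1≤t*[1+k] (≤-trans (*-monoʳ-≤ t k<r∁X) (≤-reflexive (sym (rk∁-preimage X)))) ,
    ≤-trans (s≤s conn≤t*k) (≤-reflexive (+-comm 1 (t * k)))
    where
    t*k+1≤t*[1+k] : t * k + 1 ≤ t * suc k
    t*k+1≤t*[1+k] =
      ≤-trans (+-monoʳ-≤ (t * k) 1≤t) (≤-reflexive (trans (+-comm (t * k) t) (sym (*-suc t k))))
    conn≤t*k : conn N (preimage π X) ≤ t * k
    conn≤t*k = ≤-trans (≤-reflexive (conn-preimage X)) (*-monoʳ-≤ t (≤-pred conn≤k))

  t*∣∁∪∣≤∣─preimage∣+∣─preimage∣ : ∀ Y A B →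
    t * ∣ ∁ (A ∪ B) ∣ ≤ ∣ Y ─ preimage π A ∣ + ∣ ∁ Y ─ preimage π B ∣
  t*∣∁∪∣≤∣─preimage∣+∣─preimage∣ Y A B = begin
    t * ∣ ∁ (A ∪ B) ∣                               ≡⟨ ∣preimage∣ (∁ (A ∪ B)) ⟨
    ∣ preimage π (∁ (A ∪ B)) ∣                      ≤⟨ p⊆q⇒∣p∣≤∣q∣ covered ⟩
    ∣ (Y ─ preimage π A) ∪ (∁ Y ─ preimage π B) ∣
      ≤⟨ ∣p∪q∣≤∣p∣+∣q∣ (Y ─ preimage π A) (∁ Y ─ preimage π B) ⟩
    ∣ Y ─ preimage π A ∣ + ∣ ∁ Y ─ preimage π B ∣   ∎
    where
    open ≤-Reasoning
    covered : preimage π (∁ (A ∪ B)) ⊆ (Y ─ preimage π A) ∪ (∁ Y ─ preimage π B)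
    covered {i} i∈ = cover (x∈∁p⇒x∉p (∈-preimage⁻ π {∁ (A ∪ B)} i∈))
      where
      cover : π i ∉ A ∪ B → i ∈ (Y ─ preimage π A) ∪ (∁ Y ─ preimage π B)
      cover πi∉A∪B with i ∈? Y
      ... | yes i∈Y = x∈p∪q⁺ (inj₁ (x∈p∧x∉q⇒x∈p─q i∈Y
                        (πi∉A∪B ∘ x∈p∪q⁺ ∘ inj₁ ∘ ∈-preimage⁻ π {A})))
      ... | no  i∉Y = x∈p∪q⁺ (inj₂ (x∈p∧x∉q⇒x∈p─q (x∉p⇒x∈∁p i∉Y)
                        (πi∉A∪B ∘ x∈p∪q⁺ ∘ inj₂ ∘ ∈-preimage⁻ π {B})))

  t*[k∸1]≤conn : ∀ {k} → k < rank M → BelowVerticalSeps M k →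
    ∀ Y → rk N Y < rank N → rk N (∁ Y) < rank N → t * (k ∸ 1) ≤ conn N Y
  t*[k∸1]≤conn {k} k<R minimal Y rY<rank r∁Y<rank
    with A , boundA ← blockSetBelow Y
    with B , boundB ← blockSetBelow (∁ Y) =
    +-cancelʳ-≤ (t * R) (t * (k ∸ 1)) (conn N Y) (begin
      t * (k ∸ 1) + t * R                     ≡⟨ *-distribˡ-+ t (k ∸ 1) R ⟨
      t * (k ∸ 1 + R)                         ≤⟨ *-monoʳ-≤ t k∸1+R≤a+b+d ⟩
      t * (a + b + d)                         ≡⟨ distrib t a b d ⟩
      t * a + t * b + t * d
        ≤⟨ +-monoʳ-≤ (t * a + t * b) (t*∣∁∪∣≤∣─preimage∣+∣─preimage∣ Y A B) ⟩
      t * a + t * b + (∣ Y ─ preimage π A ∣ + ∣ ∁ Y ─ preimage π B ∣)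
                                              ≡⟨ interchange (t * a) (t * b) _ _ ⟩
      (t * a + ∣ Y ─ preimage π A ∣) + (t * b + ∣ ∁ Y ─ preimage π B ∣)
                                              ≤⟨ +-mono-≤ boundA boundB ⟩
      rk N Y + rk N (∁ Y)                     ≡⟨ conn+rank N Y ⟨
      conn N Y + rank N                       ≡⟨ cong (conn N Y +_) rank-expansion ⟩
      conn N Y + t * R                        ∎)
    where
    open ≤-Reasoning
    R = rank M
    a = rk M A
    b = rk M B
    d = ∣ ∁ (A ∪ B) ∣
    distrib : ∀ t a b d → t * (a + b + d) ≡ t * a + t * b + t * d
    distrib = solve-∀
    interchange : ∀ p q u v → p + q + (u + v) ≡ (p + u) + (q + v)
    interchange = solve-∀
    rk<R : ∀ {W} C → t * rk M C + ∣ W ─ preimage π C ∣ ≤ rk N W → rk N W < rank N → rk M C < R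
    rk<R {W} C bound rW<rank = *-cancelˡ-< t (rk M C) R
      (≤-<-trans (≤-trans (m≤m+n (t * rk M C) _) bound) (subst (rk N W <_) rank-expansion rW<rank))
    k∸1+R≤a+b+d : k ∸ 1 + R ≤ a + b + d
    k∸1+R≤a+b+d = k∸1+rank≤rk+rk+∣∁∪∣ M k<R minimal A B
      (rk<R A boundA rY<rank) (rk<R B boundB r∁Y<rank)

theorem5p1 : ∀ {n} (M : Matroid n) (k : ℕ) → IsVerticalConnectivity M k → k < rank M →
    ∀ (t : ℕ) → 1 ≤ t → ∀ {m} (N : Matroid m) (π : Fin m → Fin n) → IsExpansion t M N π →
    IsVerticalConnectivity N (t * (k ∸ 1) + 1)
theorem5p1 M k (inj₂ (_ , k≡rank)) k<rank _ _ _ _ _ = contradiction k≡rank (<⇒≢ k<rank)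
theorem5p1 M zero (inj₁ ((_ , _ , _ , ()) , _)) _ _ _ _ _ _
theorem5p1 M (suc k) (inj₁ ((X , separation) , minimal)) k<rank t 1≤t N π expansion =
  inj₁ ((preimage π X , verticalSep-preimage 1≤t separation) , lowerBound)
  where
  open Expansion expansion
  lowerBound : MatroidProperties.BelowVerticalSeps N (t * k + 1)
  lowerBound j (Y , separationY) =
    let rY<rank , r∁Y<rank = MatroidProperties.verticalSep⇒rk<rank N separationY in
    ≤-trans (≤-reflexive (+-comm (t * k) 1))
      (≤-trans (s≤s (t*[k∸1]≤conn k<rank minimal Y rY<rank r∁Y<rank)) (proj₂ (proj₂ separationY)))
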